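{- Let $k\ge 2$. For every $n\ge k$, the polynomial $\mathrm{LS}_n(12\dots k)$ is monic and $$\deg \mathrm{LS}_n(12\dots k)=\binom{k-2}{2}+(k-2)(n-k+2).$$
   Context: A restricted growth function (RGF) of length $n$ is a sequence $w=w_1\dots w_n$ of positive integers with $w_1=1$ and $w_i\le 1+\max\{w_1,\dots,w_{i-1}\}$ for $i\ge 2$; $R_n$ is the set of RGFs of length $n$. The standardization of a word replaces every occurrence of its smallest letter by $1$, of its next smallest letter by $2$, and so on. An RGF $w$ contains an RGF $v$ if some subword (subsequence, not necessarily consecutive) of $w$ standardizes to $v$; otherwise $w$ avoids $v$. $R_n(v)$ is the set of $w\in R_n$ avoiding $v$; $12\dots k$ is the RGF with $w_i=i$ for $1\le i\le k$. For a word $w$ and position $j$, $\mathrm{ls}(w_j)$ is the number of distinct values $w_i$ with $i<j$ and $w_i<w_j$, and $\mathrm{ls}(w)=\sum_j\mathrm{ls}(w_j)$. $\mathrm{LS}_n(v)=\sum_{w\in R_n(v)}q^{\mathrm{ls}(w)}$. -}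

module Defs where

open import Data.Nat using (ℕ; zero; suc; _≤ᵇ_; _<ᵇ_; _≡ᵇ_; _⊔_)
open import Data.Bool using (Bool; true; false; _∧_; _∨_; not; if_then_else_)
open import Data.List using (List; []; _∷_; map; concatMap; length; upTo; foldr; sum)

-- Words are lists of naturals.  An RGF of length n is a word w with
-- w₁ = 1 and 1 ≤ wᵢ ≤ 1 + max(w₁,…,wᵢ₋₁).  Checked with a running max m
-- (starting at 0, which forces w₁ = 1).
rgfFrom : ℕ → List ℕ → Bool
rgfFrom m []       = true
rgfFrom m (x ∷ xs) = (1 ≤ᵇ x) ∧ (x ≤ᵇ suc m) ∧ rgfFrom (m ⊔ x) xs

isRGF : List ℕ → Bool
isRGF = rgfFrom 0

words : ℕ → ℕ → List (List ℕ)
words n zero    = [] ∷ []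
words n (suc l) = concatMap (λ a → map (a ∷_) (words n l)) (map suc (upTo n))

filterᵇ : {A : Set} → (A → Bool) → List A → List A
filterᵇ p []       = []
filterᵇ p (x ∷ xs) = if p x then x ∷ filterᵇ p xs else filterᵇ p xs

-- R_n : all RGFs of length n (their letters are ≤ n)
R : ℕ → List (List ℕ)
R n = filterᵇ isRGF (words n n)

elemᵇ : ℕ → List ℕ → Bool
elemᵇ x []       = false
elemᵇ x (y ∷ ys) = (x ≡ᵇ y) ∨ elemᵇ x ys

dedup : List ℕ → List ℕ
dedup []       = []
dedup (x ∷ xs) = if elemᵇ x xs then dedup xs else x ∷ dedup xs

countSmaller : ℕ → List ℕ → ℕ
countSmaller x ws = length (filterᵇ (λ y → y <ᵇ x) (dedup ws))

standardize : List ℕ → List ℕ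
standardize w = map (λ x → suc (countSmaller x w)) w

subwords : List ℕ → List (List ℕ)
subwords []       = [] ∷ []
subwords (x ∷ xs) = let s = subwords xs in map (x ∷_) s Data.List.++ s

listEqᵇ : List ℕ → List ℕ → Bool
listEqᵇ []       []       = true
listEqᵇ (x ∷ xs) (y ∷ ys) = (x ≡ᵇ y) ∧ listEqᵇ xs ys
listEqᵇ _        _        = false

anyᵇ : {A : Set} → (A → Bool) → List A → Bool
anyᵇ p []       = false
anyᵇ p (x ∷ xs) = p x ∨ anyᵇ p xs

contains : List ℕ → List ℕ → Bool
contains w v = anyᵇ (λ u → listEqᵇ (standardize u) v) (subwords w)

avoids : List ℕ → List ℕ → Bool
avoids w v = not (contains w v)

Ravoid : ℕ → List ℕ → List (List ℕ)
Ravoid n v = filterᵇ (λ w → avoids w v) (R n)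

lsFrom : List ℕ → List ℕ → ℕ
lsFrom pre []       = 0
lsFrom pre (x ∷ xs) = countSmaller x pre Data.Nat.+ lsFrom (x ∷ pre) xs

ls : List ℕ → ℕ
ls = lsFrom []

inc : ℕ → List ℕ
inc k = map suc (upTo k)

-- coefficient of q^d in LS_n(v) = Σ_{w ∈ R_n(v)} q^{ls(w)}
LScoeff : ℕ → List ℕ → ℕ → ℕ
LScoeff n v d = length (filterᵇ (λ w → ls w ≡ᵇ d) (Ravoid n v))

MonicOfDegree : (ℕ → ℕ) → ℕ → Set
MonicOfDegree c D = (c D Relation.Binary.PropositionalEquality.≡ 1)
  Data.Product.× (∀ i → D Data.Nat.< i → c i Relation.Binary.PropositionalEquality.≡ 0)
  where import Relation.Binary.PropositionalEquality
        import Data.Product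

-- In an RGF the first occurrences of 1, 2, …, j form the subword 12…j, so an RGF avoiding 12…k has
-- all letters at most k − 1; together with w_j ≤ 1 + max(w_1, …, w_{j−1}) this gives
-- w_j ≤ min(j, k − 1) for every j. Since ls(w_j) counts distinct values among 1, …, w_j − 1,
-- ls(w) ≤ Σ_j (w_j − 1) ≤ Σ_j (min(j, k − 1) − 1). Equality in the second bound forces w to be the
-- staircase 1 2 ⋯ (k−1) (k−1) ⋯ (k−1), an RGF avoiding 12…k for which the first bound is an equality too.
-- So the top coefficient counts exactly one word, and the bound evaluates to C(k−2, 2) + (k−2)(n−k+2).

module Submission where

open import Defs
open import Data.Nat
  using (ℕ; zero; suc; pred; >-nonZero; _≤_; _<_; _+_; _*_; _∸_; _⊓_; _⊔_; _≟_; _≡ᵇ_; _<ᵇ_; z≤n; s≤s; z<s)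
open import Data.Nat.Combinatorics using (_C_; nC1≡n; nCk+nC[k+1]≡[n+1]C[k+1])
open import Data.Nat.Properties
open import Data.Bool using (Bool; true; false; T; not; _∧_; _∨_)
open import Data.Bool.Properties using (T-∧)
open import Data.List using (List; []; _∷_; _++_; map; filter; length; upTo; applyUpTo; removeAt)
open import Data.List.Properties
  using (≡-dec; ∷-injectiveˡ; ∷-injectiveʳ; length-map; length-upTo; length-removeAt′; map-id-local; map-++)
open import Data.Nat.ListAction using (sum)
open import Data.Nat.ListAction.Properties using (sum-++)
open import Data.List.Relation.Unary.All as All using (All; []; _∷_)
import Data.List.Relation.Unary.All.Properties as All
open import Data.List.Relation.Unary.Any as Any using (Any; here; there; index; any?)
open import Data.List.Relation.Unary.AllPairs as AllPairs using ([]; _∷_)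
import Data.List.Relation.Unary.AllPairs.Properties as AllPairs
open import Data.List.Relation.Unary.Unique.Propositional using (Unique)
import Data.List.Relation.Unary.Unique.Propositional.Properties as Unique
open import Data.List.Relation.Binary.Pointwise using (Pointwise; []; _∷_)
open import Data.List.Relation.Binary.Sublist.Propositional using ([]; _∷_; _∷ʳ_; minimum) renaming (_⊆_ to _⊑_)
open import Data.List.Relation.Binary.Sublist.Propositional.Properties using (All-resp-⊆)
open import Data.List.Relation.Binary.Subset.Propositional using (_⊆_)
open import Data.List.Relation.Binary.Disjoint.Propositional using (Disjoint)
open import Data.List.Membership.Propositional using (_∈_; _∉_; find; lose)
open import Data.List.Membership.Propositional.Properties
  using (∈-map⁺; ∈-map⁻; ∈-++⁺ˡ; ∈-++⁺ʳ; ∈-++⁻; ∈-filter⁺; ∈-filter⁻; ∈-concatMap⁺; ∈-concatMap⁻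
        ; ∈-upTo⁺; ∈-upTo⁻)
open import Data.List.Membership.DecPropositional _≟_ using (_∈?_)
open import Data.Product using (_×_; _,_; proj₁; proj₂)
open import Data.Sum using (inj₁; inj₂)
open import Data.Empty using (⊥-elim)
open import Function using (_∘_; _⇔_; mk⇔; Equivalence)
open import Relation.Nullary using (Dec; does; proof; yes; no; ¬_; ¬?)
open import Relation.Nullary.Reflects using (Reflects; ofʸ; ofⁿ)
open import Relation.Nullary.Decidable using (T?)
open import Relation.Binary.PropositionalEquality

open Equivalence using (to; from)

T⇔ : ∀ {P : Set} {b : Bool} (P? : Dec P) → b ≡ does P? → T b ⇔ P
T⇔ (yes p) refl = mk⇔ (λ _ → p) _
T⇔ (no ¬p) refl = mk⇔ (λ ()) ¬p

filterᵇ≡filter : ∀ {A : Set} (p : A → Bool) xs → filterᵇ p xs ≡ filter (T? ∘ p) xs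
filterᵇ≡filter p [] = refl
filterᵇ≡filter p (x ∷ xs) with p x
... | true  = cong (x ∷_) (filterᵇ≡filter p xs)
... | false = filterᵇ≡filter p xs

module _ {A : Set} (p : A → Bool) {xs : List A} where

  ∈-filterᵇ⁻ : ∀ {y} → y ∈ filterᵇ p xs → y ∈ xs × T (p y)
  ∈-filterᵇ⁻ = ∈-filter⁻ (T? ∘ p) ∘ subst (_ ∈_) (filterᵇ≡filter p xs)

  ∈-filterᵇ⁺ : ∀ {y} → y ∈ xs → T (p y) → y ∈ filterᵇ p xs
  ∈-filterᵇ⁺ y∈xs py = subst (_ ∈_) (sym (filterᵇ≡filter p xs)) (∈-filter⁺ (T? ∘ p) y∈xs py)

  filterᵇ-unique : Unique xs → Unique (filterᵇ p xs)
  filterᵇ-unique = subst Unique (sym (filterᵇ≡filter p xs)) ∘ Unique.filter⁺ (T? ∘ p)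

elemᵇ≡does : ∀ x ys → elemᵇ x ys ≡ does (x ∈? ys)
elemᵇ≡does x [] = refl
elemᵇ≡does x (y ∷ ys) = cong ((x ≡ᵇ y) ∨_) (elemᵇ≡does x ys)

listEqᵇ≡does : ∀ u v → listEqᵇ u v ≡ does (≡-dec _≟_ u v)
listEqᵇ≡does [] [] = refl
listEqᵇ≡does [] (_ ∷ _) = refl
listEqᵇ≡does (_ ∷ _) [] = refl
listEqᵇ≡does (x ∷ u) (y ∷ v) = cong ((x ≡ᵇ y) ∧_) (listEqᵇ≡does u v)

anyᵇ≡does : ∀ {A : Set} (p : A → Bool) xs → anyᵇ p xs ≡ does (any? (T? ∘ p) xs)
anyᵇ≡does p [] = refl
anyᵇ≡does p (x ∷ xs) = cong (p x ∨_) (anyᵇ≡does p xs)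

elemᵇ-reflects : ∀ x ys → Reflects (x ∈ ys) (elemᵇ x ys)
elemᵇ-reflects x ys = subst (Reflects _) (sym (elemᵇ≡does x ys)) (proof (x ∈? ys))

T-listEqᵇ : ∀ {u v} → T (listEqᵇ u v) ⇔ u ≡ v
T-listEqᵇ {u} {v} = T⇔ (≡-dec _≟_ u v) (listEqᵇ≡does u v)

∈-subwords⁺ : ∀ {u w} → u ⊑ w → u ∈ subwords w
∈-subwords⁺ [] = here refl
∈-subwords⁺ (x ∷ʳ u⊑w) = ∈-++⁺ʳ _ (∈-subwords⁺ u⊑w)
∈-subwords⁺ (refl ∷ u⊑w) = ∈-++⁺ˡ (∈-map⁺ _ (∈-subwords⁺ u⊑w))

∈-subwords⁻ : ∀ {u} w → u ∈ subwords w → u ⊑ w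
∈-subwords⁻ [] (here refl) = []
∈-subwords⁻ (x ∷ w) u∈ with ∈-++⁻ (map (x ∷_) (subwords w)) u∈
... | inj₁ u∈ˡ with _ , u′∈ , refl ← ∈-map⁻ (x ∷_) u∈ˡ = refl ∷ ∈-subwords⁻ w u′∈
... | inj₂ u∈ʳ = x ∷ʳ ∈-subwords⁻ w u∈ʳ

avoids⇔ : ∀ w v → T (avoids w v) ⇔ (∀ {u} → u ⊑ w → standardize u ≢ v)
avoids⇔ w v = mk⇔ no-pattern occurrence-free
  where
  p : List ℕ → Bool
  p u = listEqᵇ (standardize u) v
  T-avoids : T (avoids w v) ⇔ (¬ Any (T ∘ p) (subwords w))
  T-avoids = T⇔ (¬? (any? (T? ∘ p) (subwords w))) (cong not (anyᵇ≡does p (subwords w)))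
  no-pattern : T (avoids w v) → ∀ {u} → u ⊑ w → standardize u ≢ v
  no-pattern av u⊑w std≡v = to T-avoids av (lose (∈-subwords⁺ u⊑w) (from T-listEqᵇ std≡v))
  occurrence-free : (∀ {u} → u ⊑ w → standardize u ≢ v) → T (avoids w v)
  occurrence-free none = from T-avoids λ occurrence →
    let _ , u∈ , std≡v = find occurrence in none (∈-subwords⁻ w u∈) (to T-listEqᵇ std≡v)

∈-dedup⁻ : ∀ {y} ws → y ∈ dedup ws → y ∈ ws
∈-dedup⁻ (x ∷ xs) y∈ with elemᵇ x xs | y∈
... | true  | y∈′        = there (∈-dedup⁻ xs y∈′)
... | false | here eq    = here eq
... | false | there y∈′  = there (∈-dedup⁻ xs y∈′)

∈-dedup⁺ : ∀ {y} ws → y ∈ ws → y ∈ dedup ws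
∈-dedup⁺ (x ∷ xs) y∈ with elemᵇ x xs | elemᵇ-reflects x xs | y∈
... | true  | ofʸ x∈xs | here refl  = ∈-dedup⁺ xs x∈xs
... | true  | _        | there y∈′  = ∈-dedup⁺ xs y∈′
... | false | _        | here refl  = here refl
... | false | _        | there y∈′  = there (∈-dedup⁺ xs y∈′)

dedup-unique : ∀ ws → Unique (dedup ws)
dedup-unique [] = []
dedup-unique (x ∷ xs) with elemᵇ x xs | elemᵇ-reflects x xs
... | true  | _        = dedup-unique xs
... | false | ofⁿ x∉xs = All.tabulate (λ { y∈ refl → x∉xs (∈-dedup⁻ xs y∈) }) ∷ dedup-unique xs

∈-removeAt : ∀ {A : Set} {x y : A} {ys} (x∈ys : x ∈ ys) → y ∈ ys → x ≢ y → y ∈ removeAt ys (index x∈ys)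
∈-removeAt (here refl) (here refl) x≢y  = ⊥-elim (x≢y refl)
∈-removeAt (here refl) (there y∈) _     = y∈
∈-removeAt (there _)   (here refl) _    = here refl
∈-removeAt (there x∈)  (there y∈) x≢y   = there (∈-removeAt x∈ y∈ x≢y)

unique-⊆⇒length-≤ : ∀ {A : Set} {xs ys : List A} → Unique xs → xs ⊆ ys → length xs ≤ length ys
unique-⊆⇒length-≤ [] _ = z≤n
unique-⊆⇒length-≤ {xs = x ∷ xs} {ys} (x≢xs ∷ xs!) xs⊆ys = begin
  suc (length xs)                         ≤⟨ s≤s (unique-⊆⇒length-≤ xs! xs⊆ys−x) ⟩
  suc (length (removeAt ys (index x∈ys))) ≡⟨ length-removeAt′ ys (index x∈ys) ⟨
  length ys                               ∎
  where
  open ≤-Reasoning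
  x∈ys = xs⊆ys (here refl)
  xs⊆ys−x : xs ⊆ removeAt ys (index x∈ys)
  xs⊆ys−x y∈xs = ∈-removeAt x∈ys (xs⊆ys (there y∈xs)) (All.lookup x≢xs y∈xs)

unique-singleton : ∀ {A : Set} {xs : List A} {x} → Unique xs → x ∈ xs → (∀ {y} → y ∈ xs → y ≡ x) →
                   length xs ≡ 1
unique-singleton {xs = _ ∷ []} _ _ _ = refl
unique-singleton {xs = _ ∷ _ ∷ _} ((y≢z ∷ _) ∷ _) _ all≡x =
  ⊥-elim (y≢z (trans (all≡x (here refl)) (sym (all≡x (there (here refl))))))

empty-length : ∀ {A : Set} {xs : List A} → (∀ {y} → y ∉ xs) → length xs ≡ 0
empty-length {xs = []} _ = refl
empty-length {xs = _ ∷ _} ∉xs = ⊥-elim (∉xs (here refl))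

∈-inc⁻ : ∀ {y k} → y ∈ inc k → 0 < y × y ≤ k
∈-inc⁻ y∈ with _ , i∈ , refl ← ∈-map⁻ suc y∈ = z<s , ∈-upTo⁻ i∈

∈-inc⁺ : ∀ {y k} → 0 < y → y ≤ k → y ∈ inc k
∈-inc⁺ {suc i} _ i<k = ∈-map⁺ suc (∈-upTo⁺ i<k)

inc-mono-⊆ : ∀ {j k} → j ≤ k → inc j ⊆ inc k
inc-mono-⊆ j≤k y∈ = let 0<y , y≤j = ∈-inc⁻ y∈ in ∈-inc⁺ 0<y (≤-trans y≤j j≤k)

inc-unique : ∀ k → Unique (inc k)
inc-unique k = Unique.map⁺ suc-injective (Unique.upTo⁺ k)

length-inc : ∀ k → length (inc k) ≡ k
length-inc k = trans (length-map suc (upTo k)) (length-upTo k)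

countSmaller-≤ : ∀ x ws → All (0 <_) ws → countSmaller x ws ≤ pred x
countSmaller-≤ x ws positive =
  subst (countSmaller x ws ≤_) (length-inc (pred x))
        (unique-⊆⇒length-≤ (filterᵇ-unique (_<ᵇ x) (dedup-unique ws)) smaller⊆)
  where
  smaller⊆ : filterᵇ (_<ᵇ x) (dedup ws) ⊆ inc (pred x)
  smaller⊆ {y} y∈ = let y∈dedup , y<ᵇx = ∈-filterᵇ⁻ (_<ᵇ x) y∈ in
    ∈-inc⁺ (All.lookup positive (∈-dedup⁻ ws y∈dedup)) (pred-mono-≤ (<ᵇ⇒< y x y<ᵇx))

countSmaller-≥ : ∀ x ws → inc (pred x) ⊆ ws → pred x ≤ countSmaller x ws
countSmaller-≥ x ws below⊆ =
  subst (_≤ countSmaller x ws) (length-inc (pred x))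
        (unique-⊆⇒length-≤ (inc-unique (pred x)) below⊆smaller)
  where
  below⊆smaller : inc (pred x) ⊆ filterᵇ (_<ᵇ x) (dedup ws)
  below⊆smaller y∈ = let 0<y , y≤pred[x] = ∈-inc⁻ y∈ in
    ∈-filterᵇ⁺ (_<ᵇ x) (∈-dedup⁺ ws (below⊆ y∈)) (<⇒<ᵇ (≤pred⇒< {x = x} 0<y y≤pred[x]))
    where
    ≤pred⇒< : ∀ {y x} → 0 < y → y ≤ pred x → y < x
    ≤pred⇒< {x = suc x} _ y≤x = s≤s y≤x
    ≤pred⇒< {x = zero} (s≤s _) ()

countSmaller-exact : ∀ x ws → All (0 <_) ws → inc (pred x) ⊆ ws → countSmaller x ws ≡ pred x
countSmaller-exact x ws positive below⊆ = ≤-antisym (countSmaller-≤ x ws positive) (countSmaller-≥ x ws below⊆)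

standardize-inc : ∀ k → standardize (inc k) ≡ inc k
standardize-inc k = map-id-local (All.tabulate λ {y} y∈ →
  let 0<y , y≤k = ∈-inc⁻ y∈ in
  trans (cong suc (countSmaller-exact y (inc k) (All.tabulate (proj₁ ∘ ∈-inc⁻))
                                        (inc-mono-⊆ (≤-trans (pred[n]≤n {y}) y≤k))))
        (suc-pred y {{>-nonZero 0<y}}))

standardize-< : ∀ {k u} → All (0 <_) u → All (_< k) u → All (_< k) (standardize u)
standardize-< {u = u} positive small = All.map⁺ (All.tabulate λ {y} y∈ →
  ≤-<-trans (subst (suc (countSmaller y u) ≤_) (suc-pred y {{>-nonZero (All.lookup positive y∈)}})
                   (s≤s (countSmaller-≤ y u positive)))
            (All.lookup small y∈))

avoids-inc : ∀ {k w} → All (0 <_) w → All (_< suc k) w → T (avoids w (inc (suc k)))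
avoids-inc {k} {w} positive small = from (avoids⇔ w (inc (suc k))) λ {u} u⊑w std≡inc →
  let std-small = standardize-< (All-resp-⊆ u⊑w positive) (All-resp-⊆ u⊑w small) in
  <-irrefl refl (All.lookup std-small (subst (suc k ∈_) (sym std≡inc) (∈-inc⁺ z<s ≤-refl)))

rgf-∷⁻ : ∀ {m x w} → T (rgfFrom m (x ∷ w)) → 0 < x × x ≤ suc m × T (rgfFrom (m ⊔ x) w)
rgf-∷⁻ {m} {x} rgf =
  let 0<x , rest = to T-∧ rgf
      x≤1+m , rgf′ = to T-∧ rest
  in ≤ᵇ⇒≤ 1 x 0<x , ≤ᵇ⇒≤ x (suc m) x≤1+m , rgf′

rgf-∷⁺ : ∀ {m x w} → 0 < x → x ≤ suc m → T (rgfFrom (m ⊔ x) w) → T (rgfFrom m (x ∷ w))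
rgf-∷⁺ 0<x x≤1+m rgf′ = from T-∧ (≤⇒≤ᵇ 0<x , from T-∧ (≤⇒≤ᵇ x≤1+m , rgf′))

rgf-positive : ∀ {m} w → T (rgfFrom m w) → All (0 <_) w
rgf-positive [] _ = []
rgf-positive {m} (x ∷ w) rgf = let 0<x , _ , rgf′ = rgf-∷⁻ {m} {x} {w} rgf in 0<x ∷ rgf-positive w rgf′

ints : ℕ → ℕ → List ℕ
ints a zero = []
ints a (suc l) = suc a ∷ ints (suc a) l

inc≡ints : ∀ k → inc k ≡ ints 0 k
inc≡ints k = shifted 0 k λ _ → refl
  where
  shifted : ∀ a l {f : ℕ → ℕ} → (∀ i → f i ≡ a + i) → map suc (applyUpTo f l) ≡ ints a l
  shifted a zero _ = refl
  shifted a (suc l) f≡ = cong₂ _∷_ (cong suc (trans (f≡ 0) (+-identityʳ a)))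
                                   (shifted (suc a) l λ i → trans (f≡ (suc i)) (+-suc a i))

-- The subword consists of the first occurrences of m+1, …, m+j.
rgf-ints-⊑ : ∀ {m} w j → T (rgfFrom m w) → Any (m + j ≤_) w → ints m j ⊑ w
rgf-ints-⊑ w zero _ _ = minimum w
rgf-ints-⊑ {m} (x ∷ w) (suc j) rgf reaches
  with _ , x≤1+m , rgf′ ← rgf-∷⁻ {m} {x} {w} rgf
  with m≤n⇒m<n∨m≡n x≤1+m | reaches
... | inj₁ x<1+m | here m+1+j≤x = ⊥-elim (<⇒≱ (m<m+n m z<s) (≤-trans m+1+j≤x (≤-pred x<1+m)))
... | inj₁ x<1+m | there later  =
  x ∷ʳ rgf-ints-⊑ w (suc j) (subst (λ m′ → T (rgfFrom m′ w)) (m≥n⇒m⊔n≡m (≤-pred x<1+m)) rgf′) later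
... | inj₂ refl  | _ with j
...   | zero    = refl ∷ minimum w
...   | suc j′ with reaches
...     | here m+2+j′≤1+m =
  ⊥-elim (<⇒≱ (m<m+n m z<s) (≤-pred (subst (_≤ suc m) (+-suc m (suc j′)) m+2+j′≤1+m)))
...     | there later =
  refl ∷ rgf-ints-⊑ w (suc j′) (subst (λ m′ → T (rgfFrom m′ w)) (m≤n⇒m⊔n≡n (n≤1+n m)) rgf′)
                               (subst (λ h → Any (h ≤_) w) (+-suc m (suc j′)) later)

rgf-avoids-inc⇒< : ∀ {k w} → T (isRGF w) → T (avoids w (inc k)) → All (_< k) w
rgf-avoids-inc⇒< {k} {w} rgf av = All.tabulate λ {y} y∈ → ≰⇒> λ k≤y →
  to (avoids⇔ w (inc k)) av
     (subst (_⊑ w) (sym (inc≡ints k)) (rgf-ints-⊑ w k rgf (Any.map (λ { refl → k≤y }) y∈)))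
     (standardize-inc k)

weight : List ℕ → ℕ
weight w = sum (map pred w)

weight-++ : ∀ u w → weight (u ++ w) ≡ weight u + weight w
weight-++ u w = trans (cong sum (map-++ pred u w)) (sum-++ (map pred u) (map pred w))

lsFrom-≤-weight : ∀ {pre} w → All (0 <_) pre → All (0 <_) w → lsFrom pre w ≤ weight w
lsFrom-≤-weight [] _ _ = z≤n
lsFrom-≤-weight {pre} (x ∷ w) pre-pos (0<x ∷ w-pos) =
  +-mono-≤ (countSmaller-≤ x pre pre-pos) (lsFrom-≤-weight w (0<x ∷ pre-pos) w-pos)

weight-mono : ∀ {u w} → Pointwise _≤_ u w → weight u ≤ weight w
weight-mono [] = z≤n
weight-mono (x≤y ∷ u≤w) = +-mono-≤ (pred-mono-≤ x≤y) (weight-mono u≤w)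

weight-injective : ∀ {u w} → All (0 <_) u → Pointwise _≤_ u w → weight u ≡ weight w → u ≡ w
weight-injective [] [] _ = refl
weight-injective {x ∷ u} {y ∷ w} (0<x ∷ u-pos) (x≤y ∷ u≤w) eq =
  cong₂ _∷_ (pred-injective {{>-nonZero 0<x}} {{>-nonZero (<-≤-trans 0<x x≤y)}} pred≡)
            (weight-injective u-pos u≤w (+-cancelˡ-≡ (pred x) _ _ (trans eq (cong (_+ weight w) (sym pred≡)))))
  where
  pred≡ : pred x ≡ pred y
  pred≡ = ≤-antisym (pred-mono-≤ x≤y) (≮⇒≥ λ px<py → <⇒≢ (+-mono-<-≤ px<py (weight-mono u≤w)) eq)

-- stair K 0 n = 1 2 ⋯ K (K+1) (K+1) ⋯ (K+1), of length n; the letter at position p+1 is min(p, K) + 1.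
stair : ℕ → ℕ → ℕ → List ℕ
stair K p zero = []
stair K p (suc l) = suc (p ⊓ K) ∷ stair K (suc p) l

length-stair : ∀ K p l → length (stair K p l) ≡ l
length-stair K p zero = refl
length-stair K p (suc l) = cong suc (length-stair K (suc p) l)

stair-letters : ∀ K p l → All (_∈ inc (suc K)) (stair K p l)
stair-letters K p zero = []
stair-letters K p (suc l) = ∈-inc⁺ z<s (s≤s (m⊓n≤n p K)) ∷ stair-letters K (suc p) l

stair-positive : ∀ K p l → All (0 <_) (stair K p l)
stair-positive K p l = All.map (proj₁ ∘ ∈-inc⁻) (stair-letters K p l)

stair-rgf : ∀ K p l → T (rgfFrom (p ⊓ suc K) (stair K p l))
stair-rgf K p zero = _
stair-rgf K p (suc l) =
  rgf-∷⁺ {p ⊓ suc K} {suc (p ⊓ K)} {stair K (suc p) l} z<s (s≤s (⊓-monoʳ-≤ p (n≤1+n K)))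
  (subst (λ m → T (rgfFrom m (stair K (suc p) l))) (sym (m≤n⇒m⊔n≡n (⊓-monoˡ-≤ (suc K) (n≤1+n p))))
         (stair-rgf K (suc p) l))

lsFrom-stair : ∀ K p l {pre} → All (0 <_) pre → inc (p ⊓ suc K) ⊆ pre →
               lsFrom pre (stair K p l) ≡ weight (stair K p l)
lsFrom-stair K p zero _ _ = refl
lsFrom-stair K p (suc l) {pre} pre-pos below⊆ =
  cong₂ _+_ (countSmaller-exact (suc (p ⊓ K)) pre pre-pos (below⊆ ∘ inc-mono-⊆ (⊓-monoʳ-≤ p (n≤1+n K))))
            (lsFrom-stair K (suc p) l (z<s ∷ pre-pos) below′⊆)
  where
  below′⊆ : inc (suc (p ⊓ K)) ⊆ suc (p ⊓ K) ∷ pre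
  below′⊆ {y} y∈ with y ≟ suc (p ⊓ K)
  ... | yes refl = here refl
  ... | no y≢ = let 0<y , y≤ = ∈-inc⁻ y∈ in
    there (below⊆ (∈-inc⁺ 0<y (≤-trans (≤-pred (≤∧≢⇒< y≤ y≢)) (⊓-monoʳ-≤ p (n≤1+n K)))))

rgf-≤-stair : ∀ K {m p} w → m ≤ p → T (rgfFrom m w) → All (_≤ suc K) w →
              Pointwise _≤_ w (stair K p (length w))
rgf-≤-stair K [] _ _ _ = []
rgf-≤-stair K {m} {p} (x ∷ w) m≤p rgf (x≤1+K ∷ w≤1+K) =
  let _ , x≤1+m , rgf′ = rgf-∷⁻ {m} {x} {w} rgf
      x≤1+p = ≤-trans x≤1+m (s≤s m≤p)
  in ⊓-glb x≤1+p x≤1+K ∷ rgf-≤-stair K w (⊔-lub (m≤n⇒m≤1+n m≤p) x≤1+p) rgf′ w≤1+K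

stair-++ : ∀ K p a b → stair K p (a + b) ≡ stair K p a ++ stair K (p + a) b
stair-++ K p zero b = cong (λ q → stair K q b) (sym (+-identityʳ p))
stair-++ K p (suc a) b = cong (suc (p ⊓ K) ∷_) (trans (stair-++ K (suc p) a b)
  (cong (λ q → stair K (suc p) a ++ stair K q b) (sym (+-suc p a))))

weight-stair-rising : ∀ K p j → p + j ≤ K → p C 2 + weight (stair K p j) ≡ (p + j) C 2
weight-stair-rising K p zero _ = trans (+-identityʳ (p C 2)) (cong (_C 2) (sym (+-identityʳ p)))
weight-stair-rising K p (suc j) p+1+j≤K = begin
  p C 2 + (p ⊓ K + rest)   ≡⟨ cong (λ c → p C 2 + (c + rest)) (m≤n⇒m⊓n≡m p≤K) ⟩
  p C 2 + (p + rest)       ≡⟨ +-assoc (p C 2) p rest ⟨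
  (p C 2 + p) + rest       ≡⟨ cong (_+ rest) pascal ⟩
  suc p C 2 + rest         ≡⟨ weight-stair-rising K (suc p) j (subst (_≤ K) (+-suc p j) p+1+j≤K) ⟩
  (suc p + j) C 2          ≡⟨ cong (_C 2) (+-suc p j) ⟨
  (p + suc j) C 2          ∎
  where
  open ≡-Reasoning
  rest = weight (stair K (suc p) j)
  p≤K = ≤-trans (m≤m+n p (suc j)) p+1+j≤K
  pascal : p C 2 + p ≡ suc p C 2
  pascal = trans (+-comm (p C 2) p) (trans (cong (_+ p C 2) (sym (nC1≡n p))) (nCk+nC[k+1]≡[n+1]C[k+1] p 1))

weight-stair-flat : ∀ K p l → K ≤ p → weight (stair K p l) ≡ l * K
weight-stair-flat K p zero _ = refl
weight-stair-flat K p (suc l) K≤p =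
  cong₂ _+_ (m≥n⇒m⊓n≡n K≤p) (weight-stair-flat K (suc p) l (m≤n⇒m≤1+n K≤p))

weight-stair : ∀ K {n} → K ≤ n → weight (stair K 0 n) ≡ K C 2 + K * (n ∸ K)
weight-stair K K≤n with t , refl ← m≤n⇒∃[o]m+o≡n K≤n = begin
  weight (stair K 0 (K + t))
    ≡⟨ cong weight (stair-++ K 0 K t) ⟩
  weight (stair K 0 K ++ stair K K t)
    ≡⟨ weight-++ (stair K 0 K) (stair K K t) ⟩
  weight (stair K 0 K) + weight (stair K K t)
    ≡⟨ cong₂ _+_ (weight-stair-rising K 0 K ≤-refl) (weight-stair-flat K K t ≤-refl) ⟩
  K C 2 + t * K
    ≡⟨ cong (K C 2 +_) (trans (*-comm t K) (cong (K *_) (sym (m+n∸m≡n K t)))) ⟩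
  K C 2 + K * (K + t ∸ K)
    ∎
  where open ≡-Reasoning

∈-words⁻ : ∀ n l {w} → w ∈ words n l → length w ≡ l
∈-words⁻ n zero (here refl) = refl
∈-words⁻ n (suc l) w∈
  with a , w∈ₐ ← Any.satisfied (∈-concatMap⁻ (λ a → map (a ∷_) (words n l)) {xs = inc n} w∈)
  with w′ , w′∈ , refl ← ∈-map⁻ (a ∷_) w∈ₐ = cong suc (∈-words⁻ n l w′∈)

∈-words⁺ : ∀ n {w} → All (_∈ inc n) w → w ∈ words n (length w)
∈-words⁺ n [] = here refl
∈-words⁺ n {x ∷ w} (x∈ ∷ w∈) =
  ∈-concatMap⁺ (λ a → map (a ∷_) (words n (length w)))
               (Any.map (λ { refl → ∈-map⁺ (x ∷_) (∈-words⁺ n w∈) }) x∈)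

words-unique : ∀ n l → Unique (words n l)
words-unique n zero = [] ∷ []
words-unique n (suc l) =
  Unique.concat⁺ (All.map⁺ (All.universal (λ a → Unique.map⁺ ∷-injectiveʳ (words-unique n l)) (inc n)))
                 (AllPairs.map⁺ (AllPairs.map different-heads (inc-unique n)))
  where
  different-heads : ∀ {a b} → a ≢ b → Disjoint (map (a ∷_) (words n l)) (map (b ∷_) (words n l))
  different-heads a≢b (u∈ₐ , u∈b)
    with _ , _ , refl ← ∈-map⁻ _ u∈ₐ
    with _ , _ , eq ← ∈-map⁻ _ u∈b = a≢b (∷-injectiveˡ eq)

LSterms : ℕ → List ℕ → ℕ → List (List ℕ)
LSterms n v d = filterᵇ (λ w → ls w ≡ᵇ d) (Ravoid n v)

LSterms-unique : ∀ n v d → Unique (LSterms n v d)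
LSterms-unique n v d = filterᵇ-unique _ (filterᵇ-unique _ (filterᵇ-unique isRGF (words-unique n n)))

∈-LSterms⁻ : ∀ n v d {w} → w ∈ LSterms n v d → length w ≡ n × T (isRGF w) × T (avoids w v) × ls w ≡ d
∈-LSterms⁻ n v d {w} w∈ =
  let w∈Ravoid , ls≡ᵇd = ∈-filterᵇ⁻ (λ w → ls w ≡ᵇ d) w∈
      w∈R , av        = ∈-filterᵇ⁻ (λ w → avoids w v) w∈Ravoid
      w∈words , rgf   = ∈-filterᵇ⁻ isRGF w∈R
  in ∈-words⁻ n n w∈words , rgf , av , ≡ᵇ⇒≡ (ls w) d ls≡ᵇd

∈-LSterms⁺ : ∀ n v {w} → w ∈ words n n → T (isRGF w) → T (avoids w v) → w ∈ LSterms n v (ls w)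
∈-LSterms⁺ n v {w} w∈ rgf av =
  ∈-filterᵇ⁺ (λ w → ls w ≡ᵇ _) (∈-filterᵇ⁺ (λ w → avoids w v) (∈-filterᵇ⁺ isRGF w∈ rgf) av)
             (≡⇒≡ᵇ (ls w) (ls w) refl)

avoider-≤-stair : ∀ K {n} w → length w ≡ n → T (isRGF w) → T (avoids w (inc (2 + K))) →
                  Pointwise _≤_ w (stair K 0 n)
avoider-≤-stair K w refl rgf av = rgf-≤-stair K w z≤n rgf (All.map ≤-pred (rgf-avoids-inc⇒< rgf av))

ls≤weight-stair : ∀ K {n} w → length w ≡ n → T (isRGF w) → T (avoids w (inc (2 + K))) →
                  ls w ≤ weight (stair K 0 n)
ls≤weight-stair K w len rgf av =
  ≤-trans (lsFrom-≤-weight w [] (rgf-positive w rgf)) (weight-mono (avoider-≤-stair K w len rgf av))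

ls≡weight-stair⇒≡stair : ∀ K {n} w → length w ≡ n → T (isRGF w) → T (avoids w (inc (2 + K))) →
                         ls w ≡ weight (stair K 0 n) → w ≡ stair K 0 n
ls≡weight-stair⇒≡stair K w len rgf av ls≡ =
  weight-injective (rgf-positive w rgf) w≤stair
    (≤-antisym (weight-mono w≤stair) (subst (_≤ weight w) ls≡ (lsFrom-≤-weight w [] (rgf-positive w rgf))))
  where w≤stair = avoider-≤-stair K w len rgf av

stair-avoids : ∀ K n → T (avoids (stair K 0 n) (inc (2 + K)))
stair-avoids K n = avoids-inc (stair-positive K 0 n) (All.map (s≤s ∘ proj₂ ∘ ∈-inc⁻) (stair-letters K 0 n))

ls-stair : ∀ K n → ls (stair K 0 n) ≡ weight (stair K 0 n)
ls-stair K n = lsFrom-stair K 0 n [] λ ()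

stair∈words : ∀ K {n} → suc K ≤ n → stair K 0 n ∈ words n n
stair∈words K {n} K<n = subst (λ l → stair K 0 n ∈ words n l) (length-stair K 0 n)
  (∈-words⁺ n (All.map (inc-mono-⊆ K<n) (stair-letters K 0 n)))

LS-monic : ∀ K {n} → suc K ≤ n → MonicOfDegree (LScoeff n (inc (2 + K))) (weight (stair K 0 n))
LS-monic K {n} K<n = leading , vanishing
  where
  leading : LScoeff n (inc (2 + K)) (weight (stair K 0 n)) ≡ 1
  leading = unique-singleton (LSterms-unique n _ _)
    (subst (λ d → stair K 0 n ∈ LSterms n _ d) (ls-stair K n)
           (∈-LSterms⁺ n _ (stair∈words K K<n) (stair-rgf K 0 n) (stair-avoids K n)))
    (λ {w} w∈ → let len , rgf , av , ls≡ = ∈-LSterms⁻ n _ _ w∈ in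
                 ls≡weight-stair⇒≡stair K w len rgf av ls≡)
  vanishing : ∀ d → weight (stair K 0 n) < d → LScoeff n (inc (2 + K)) d ≡ 0
  vanishing d D<d = empty-length λ {w} w∈ →
    let len , rgf , av , ls≡d = ∈-LSterms⁻ n _ d w∈ in
    <⇒≱ D<d (subst (_≤ _) ls≡d (ls≤weight-stair K w len rgf av))

proposition4p4 : (k : ℕ) → 2 ≤ k → (n : ℕ) → k ≤ n →
    MonicOfDegree (LScoeff n (inc k)) (((k ∸ 2) C 2) + (k ∸ 2) * (n ∸ k + 2))
proposition4p4 (suc (suc K)) (s≤s (s≤s z≤n)) (suc (suc n)) (s≤s (s≤s K≤n)) =
  subst (MonicOfDegree (LScoeff (2 + n) (inc (2 + K)))) degree (LS-monic K (m≤n⇒m≤1+n (s≤s K≤n)))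
  where
  open ≡-Reasoning
  degree : weight (stair K 0 (2 + n)) ≡ K C 2 + K * (n ∸ K + 2)
  degree = begin
    weight (stair K 0 (2 + n)) ≡⟨ weight-stair K (m≤n⇒m≤o+n 2 K≤n) ⟩
    K C 2 + K * (2 + n ∸ K)    ≡⟨ cong (λ e → K C 2 + K * e) (trans (+-∸-assoc 2 K≤n) (+-comm 2 (n ∸ K))) ⟩
    K C 2 + K * (n ∸ K + 2)    ∎
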